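{- Let $\mathbf{d}=(d_1,\ldots,d_n)$ be an arranged degree sequence, and let $$\ell^*=\min\Big\{\ell\ge 0,\ 2\ell\le n\ :\ \sum_{i=1}^{2\ell}\min\{d_i-1,k\}\ge\sum_{i=2\ell+1}^{2\ell+k}d_i\ \text{ for all } k=1,\ldots,n-2\ell\Big\}.$$ Then every maximal matching $M$ in every realization of $\mathbf{d}$ satisfies $|M|\ge\ell^*$.
   Context: Arranged means $d_1\ge\cdots\ge d_n$. A realization of $\mathbf{d}$ is a simple graph (with vertex labelling) whose degree sequence is $\mathbf{d}$. A matching is a set of pairwise disjoint edges; it is maximal if it is not a proper subset of another matching. -}

module Defs where

open import Data.Nat using (ℕ; zero; suc; _+_; _*_; _∸_; _≤_)
open import Data.Integer as ℤ using (ℤ; +_; _⊓_)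
open import Data.Fin using (Fin; toℕ)
import Data.Fin as Fin
open import Data.Bool using (Bool; true; false; if_then_else_)
open import Data.Nat.ListAction using (sum)
open import Data.List using (List; []; _∷_; map; upTo; allFin; foldr; concatMap; length)
open import Data.List.Relation.Unary.All using (All)
open import Data.List.Relation.Unary.Unique.Propositional using (Unique)
open import Data.Product using (_×_; proj₁; proj₂)
open import Relation.Binary.PropositionalEquality using (_≡_)
open import Relation.Nullary using (¬_)

record SimpleGraph (n : ℕ) : Set where
  field
    adj     : Fin n → Fin n → Bool
    sym     : ∀ u v → adj u v ≡ adj v u
    irrefl  : ∀ v → adj v v ≡ false
open SimpleGraph public

degree : ∀ {n} → SimpleGraph n → Fin n → ℕ
degree {n} G v = sum (map (λ u → if adj G v u then 1 else 0) (allFin n))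

-- Vertices are labelled 0..n-1 (d_1 is d at index 0).
Arranged : ∀ {n} → (Fin n → ℕ) → Set
Arranged {n} d = ∀ (i j : Fin n) → toℕ i ≤ toℕ j → d j ≤ d i

Realizes : ∀ {n} → SimpleGraph n → (Fin n → ℕ) → Set
Realizes {n} G d = ∀ v → degree G v ≡ d v

IsMatching : ∀ {n} → SimpleGraph n → List (Fin n × Fin n) → Set
IsMatching G M =
  All (λ e → adj G (proj₁ e) (proj₂ e) ≡ true) M
  × Unique (concatMap (λ e → proj₁ e ∷ proj₂ e ∷ []) M)

IsMaximalMatching : ∀ {n} → SimpleGraph n → List (Fin n × Fin n) → Set
IsMaximalMatching G M =
  IsMatching G M × (∀ u v → adj G u v ≡ true → ¬ IsMatching G ((u Data.Product., v) ∷ M))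

-- 0-indexed access to d as a function on ℕ (0 outside range; only used in range)
at : ∀ {n} → (Fin n → ℕ) → ℕ → ℕ
at {zero}  d i       = 0
at {suc n} d zero    = d Fin.zero
at {suc n} d (suc i) = at (λ j → d (Fin.suc j)) i

sumℤ : List ℤ → ℤ
sumℤ = foldr ℤ._+_ (+ 0)

Admissible : ∀ {n} → (Fin n → ℕ) → ℕ → Set
Admissible {n} d ℓ =
  2 * ℓ ≤ n ×
  (∀ k → 1 ≤ k → k ≤ n ∸ 2 * ℓ →
     (+ sum (map (λ j → at d (2 * ℓ + j)) (upTo k)))
       ℤ.≤ sumℤ (map (λ i → (+ at d i ℤ.- + 1) ⊓ + k) (upTo (2 * ℓ))))

IsLStar : ∀ {n} → (Fin n → ℕ) → ℕ → Set
IsLStar d ℓ* = Admissible d ℓ* × (∀ ℓ → Admissible d ℓ → ℓ* ≤ ℓ)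

{-# OPTIONS --safe #-}
-- Let M be a maximal matching with m edges and B its 2m matched vertices. By maximality the
-- unmatched vertices are independent, so every neighbour of an unmatched vertex lies in B.
-- Given k ≤ n − 2m, let S be the first k unmatched vertices; as d is arranged, their degrees
-- dominate d_{2m+1}, …, d_{2m+k}. Counting the edges between S and B from the side of B, a
-- vertex w ∈ B has at most k neighbours in S, and at most d_w − 1 because its partner is not
-- in S. Hence Σ_S d ≤ Σ_{w ∈ B} min(d_w − 1, k) ≤ Σ_{i ≤ 2m} min(d_i − 1, k), so ℓ = m
-- satisfies the condition defining ℓ*, and ℓ* ≤ m by minimality.
module Submission where

open import Defs
open import Data.Bool using (Bool; true; false; T; if_then_else_)
open import Data.Empty using (⊥-elim)
open import Data.Fin using (Fin; zero; suc; toℕ)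
open import Data.Fin.Properties using (_≟_)
import Data.Integer as ℤ
import Data.Integer.Properties as ℤ
open import Data.List using (List; []; _∷_; length; map; upTo; allFin; tabulate; applyUpTo; concatMap)
open import Data.List.Properties using (map-tabulate; map-upTo; map-cong-local)
open import Data.List.Relation.Unary.All using (All; _∷_)
open import Data.List.Relation.Unary.All.Properties using (applyUpTo⁺₁; ¬Any⇒All¬; All¬⇒¬Any)
open import Data.List.Relation.Unary.AllPairs using (_∷_)
open import Data.List.Relation.Unary.Any using (here; there)
open import Data.List.Relation.Unary.Unique.Propositional using (Unique)
open import Data.Nat using (ℕ; zero; suc; _+_; _*_; _∸_; _⊓_; _≤_; _<_; z≤n; s≤s)
open import Data.Nat.ListAction using (sum)
open import Data.Nat.Properties
  using ( +-0-commutativeMonoid; +-comm; +-assoc; +-suc; *-suc; +-mono-≤; +-monoʳ-≤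
        ; ≤-refl; ≤-trans; ≤-pred; ≤-reflexive; m≤n+m; m+n≤o⇒m≤o∸n; m≤o∸n⇒m+n≤o
        ; ⊓-glb; ⊓-monoˡ-≤; ∸-monoˡ-≤; module ≤-Reasoning)
open import Algebra.Properties.CommutativeMonoid.Sum +-0-commutativeMonoid
  using (sum-syntax; sum-cong-≗; ∑-comm; ∑-distrib-+; sum-replicate-zero)
open import Data.Product using (_×_; _,_; proj₁; proj₂; ∃-syntax)
open import Function using (_∘_)
open import Relation.Binary.PropositionalEquality as ≡
  using (_≡_; refl; trans; cong; cong₂; subst; subst₂)
open import Relation.Nullary using (¬_; does; yes; no)
open import Relation.Nullary.Decidable using (dec-false)

infixr 7 _·_

_·_ : Bool → ℕ → ℕ
b · x = if b then x else 0

∣_∣ : ∀ {n} → (Fin n → Bool) → ℕ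
∣_∣ {n} s = ∑[ v < n ] (s v · 1)

·-≤ : ∀ b x → b · x ≤ x
·-≤ true  x = ≤-refl
·-≤ false x = z≤n

·-monoʳ-≤ : ∀ b {x y} → x ≤ y → b · x ≤ b · y
·-monoʳ-≤ true  x≤y = x≤y
·-monoʳ-≤ false x≤y = z≤n

·-∑ : ∀ {n} b (f : Fin n → ℕ) → b · (∑[ v < n ] f v) ≡ ∑[ v < n ] (b · f v)
·-∑     true  f = refl
·-∑ {n} false f = ≡.sym (sum-replicate-zero n)

∑-mono-≤ : ∀ {n} {f g : Fin n → ℕ} → (∀ v → f v ≤ g v) →
  ∑[ v < n ] f v ≤ ∑[ v < n ] g v
∑-mono-≤ {zero}  f≤g = z≤n
∑-mono-≤ {suc n} f≤g = +-mono-≤ (f≤g zero) (∑-mono-≤ (λ v → f≤g (suc v)))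

∑-restrict+outside≤∑ : ∀ {n} (s : Fin n → Bool) (f : Fin n → ℕ) {p} → ¬ T (s p) →
  (∑[ v < n ] (s v · f v)) + f p ≤ ∑[ v < n ] f v
∑-restrict+outside≤∑ {suc n} s f {zero} p∉s with s zero
... | true  = ⊥-elim (p∉s _)
... | false = begin
  (∑[ v < n ] (s (suc v) · f (suc v))) + f zero
    ≡⟨ +-comm _ (f zero) ⟩
  f zero + ∑[ v < n ] (s (suc v) · f (suc v))
    ≤⟨ +-monoʳ-≤ (f zero) (∑-mono-≤ (λ v → ·-≤ (s (suc v)) _)) ⟩
  f zero + ∑[ v < n ] f (suc v)
    ∎
  where open ≤-Reasoning
∑-restrict+outside≤∑ {suc n} s f {suc p} p∉s = begin
  s zero · f zero + (∑[ v < n ] (s (suc v) · f (suc v))) + f (suc p)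
    ≡⟨ +-assoc (s zero · f zero) _ _ ⟩
  s zero · f zero + ((∑[ v < n ] (s (suc v) · f (suc v))) + f (suc p))
    ≤⟨ +-mono-≤ (·-≤ (s zero) _) (∑-restrict+outside≤∑ (s ∘ suc) (f ∘ suc) p∉s) ⟩
  f zero + ∑[ v < n ] f (suc v)
    ∎
  where open ≤-Reasoning

∣∣≤n : ∀ {n} (s : Fin n → Bool) → ∣ s ∣ ≤ n
∣∣≤n {zero}  s = z≤n
∣∣≤n {suc n} s = +-mono-≤ (·-≤ (s zero) 1) (∣∣≤n (s ∘ suc))

∣≟∣≡1 : ∀ {n} (x : Fin n) → ∣ (λ v → does (v ≟ x)) ∣ ≡ 1
∣≟∣≡1 {suc n} zero    = cong suc (sum-replicate-zero n)
∣≟∣≡1 {suc n} (suc x) = ∣≟∣≡1 x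

sum-tabulate : ∀ {n} (f : Fin n → ℕ) → sum (tabulate f) ≡ ∑[ v < n ] f v
sum-tabulate {zero}  f = refl
sum-tabulate {suc n} f = cong (f zero +_) (sum-tabulate (f ∘ suc))

sum-allFin : ∀ {n} (f : Fin n → ℕ) → sum (map f (allFin n)) ≡ ∑[ v < n ] f v
sum-allFin f = trans (cong sum (map-tabulate (λ v → v) f)) (sum-tabulate f)

sum-applyUpTo : ∀ t (f : ℕ → ℕ) → sum (applyUpTo f t) ≡ ∑[ i < t ] f (toℕ i)
sum-applyUpTo zero    f = refl
sum-applyUpTo (suc t) f = cong (f 0 +_) (sum-applyUpTo t (f ∘ suc))

sum-upTo : ∀ t (f : ℕ → ℕ) → sum (map f (upTo t)) ≡ ∑[ i < t ] f (toℕ i)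
sum-upTo t f = trans (cong sum (map-upTo f t)) (sum-applyUpTo t f)

sumℤ-+ : ∀ (f : ℕ → ℕ) xs → sumℤ (map (λ x → ℤ.+ f x) xs) ≡ ℤ.+ sum (map f xs)
sumℤ-+ f []       = refl
sumℤ-+ f (x ∷ xs) = trans (cong (ℤ._+_ (ℤ.+ f x)) (sumℤ-+ f xs)) (≡.sym (ℤ.pos-+ (f x) _))

Arranged-tail : ∀ {n} (h : Fin (suc n) → ℕ) → Arranged h → Arranged (h ∘ suc)
Arranged-tail h h↓ i j i≤j = h↓ (suc i) (suc j) (s≤s i≤j)

Arranged-∘ : ∀ {n} (h : Fin n → ℕ) {g : ℕ → ℕ} → (∀ {x y} → x ≤ y → g x ≤ g y) →
  Arranged h → Arranged (g ∘ h)
Arranged-∘ h g↑ h↓ i j i≤j = g↑ (h↓ i j i≤j)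

at-suc≤at : ∀ {n} (h : Fin n → ℕ) → Arranged h → ∀ i → at h (suc i) ≤ at h i
at-suc≤at {zero}        h h↓ i       = z≤n
at-suc≤at {suc zero}    h h↓ zero    = z≤n
at-suc≤at {suc (suc n)} h h↓ zero    = h↓ zero (suc zero) z≤n
at-suc≤at {suc n}       h h↓ (suc i) = at-suc≤at (h ∘ suc) (Arranged-tail h h↓) i

at≤at-zero : ∀ {n} (h : Fin n → ℕ) → Arranged h → ∀ i → at h i ≤ at h 0
at≤at-zero h h↓ zero    = ≤-refl
at≤at-zero h h↓ (suc i) = ≤-trans (at-suc≤at h h↓ i) (at≤at-zero h h↓ i)

at-∘ : ∀ {n} (h : Fin n → ℕ) (g : ℕ → ℕ) i → at (g ∘ h) i ≤ g (at h i)
at-∘ {zero}  h g i       = z≤n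
at-∘ {suc n} h g zero    = ≤-refl
at-∘ {suc n} h g (suc i) = at-∘ (h ∘ suc) g i

∑-restrict≤∑-prefix : ∀ {n} (h : Fin n → ℕ) → Arranged h → (b : Fin n → Bool) →
  ∑[ v < n ] (b v · h v) ≤ ∑[ i < ∣ b ∣ ] at h (toℕ i)
∑-restrict≤∑-prefix {zero}  h h↓ b = z≤n
∑-restrict≤∑-prefix {suc n} h h↓ b =
  cons (b zero) (∑-restrict≤∑-prefix (h ∘ suc) (Arranged-tail h h↓) (b ∘ suc))
  where
  cons : ∀ c {S} → S ≤ ∑[ i < ∣ b ∘ suc ∣ ] at h (suc (toℕ i)) →
    c · h zero + S ≤ ∑[ i < c · 1 + ∣ b ∘ suc ∣ ] at h (toℕ i)
  cons true  S≤ = +-monoʳ-≤ (h zero) S≤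
  cons false S≤ = ≤-trans S≤ (∑-mono-≤ {n = ∣ b ∘ suc ∣} (λ i → at-suc≤at h h↓ (toℕ i)))

≤-at-prefix : ∀ {n} (h : Fin n → ℕ) {x} → Arranged h → (b : Fin n → Bool) →
  (∀ v → T (b v) → x ≤ h v) → ∀ i → i < ∣ b ∣ → x ≤ at h i
≤-at-prefix {suc n} h h↓ b x≤b i i<∣b∣ with b zero in b₀
≤-at-prefix {suc n} h h↓ b x≤b zero    _           | true = x≤b zero (subst T (≡.sym b₀) _)
≤-at-prefix {suc n} h h↓ b x≤b (suc i) (s≤s i<∣b∣) | true =
  ≤-at-prefix (h ∘ suc) (Arranged-tail h h↓) (b ∘ suc) (λ v → x≤b (suc v)) i i<∣b∣
... | false =
  ≤-trans (≤-at-prefix (h ∘ suc) (Arranged-tail h h↓) (b ∘ suc) (λ v → x≤b (suc v)) i i<∣b∣)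
          (at-suc≤at h h↓ i)

-- The witness s consists of the first k vertices outside b; the j-th of them has index at most ∣ b ∣ + j.
∃-disjoint-dominating-window : ∀ {n} (h : Fin n → ℕ) → Arranged h → (b : Fin n → Bool) →
  ∀ k → k + ∣ b ∣ ≤ n →
  ∃[ s ] (∀ v → T (s v) → ¬ T (b v)) × ∣ s ∣ ≡ k ×
         ∑[ j < k ] at h (∣ b ∣ + toℕ j) ≤ ∑[ v < n ] (s v · h v)
∃-disjoint-dominating-window {n} h h↓ b zero _ =
  (λ _ → false) , (λ _ ()) , sum-replicate-zero n , z≤n
∃-disjoint-dominating-window {suc n} h h↓ b (suc k) k+∣b∣≤n with b zero in b₀
... | true
  with s , s∩b=∅ , ∣s∣≡k , dominates ←
       ∃-disjoint-dominating-window (h ∘ suc) (Arranged-tail h h↓) (b ∘ suc) (suc k)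
         (≤-pred (subst (_≤ suc n) (+-suc (suc k) _) k+∣b∣≤n))
  = s′ , disjoint , ∣s∣≡k , dominates
  where
  s′ : Fin (suc n) → Bool
  s′ zero    = false
  s′ (suc v) = s v
  disjoint : ∀ v → T (s′ v) → ¬ T (b v)
  disjoint zero    ()
  disjoint (suc v) = s∩b=∅ v
... | false
  with s , s∩b=∅ , ∣s∣≡k , dominates ←
       ∃-disjoint-dominating-window (h ∘ suc) (Arranged-tail h h↓) (b ∘ suc) k (≤-pred k+∣b∣≤n)
  = s′ , disjoint , cong suc ∣s∣≡k ,
    +-mono-≤ (at≤at-zero h h↓ (∣ b ∘ suc ∣ + 0))
             (≤-trans (∑-mono-≤ {n = k} (λ j → ≤-reflexive (cong (at h) (+-suc _ (toℕ j))))) dominates)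
  where
  s′ : Fin (suc n) → Bool
  s′ zero    = true
  s′ (suc v) = s v
  disjoint : ∀ v → T (s′ v) → ¬ T (b v)
  disjoint zero    _ = subst T b₀
  disjoint (suc v) = s∩b=∅ v

-- The condition defining ℓ*, for c = 2ℓ, read in ℕ; the truncated d_i ∸ 1 agrees with the
-- integer d_i − 1 of Admissible as long as d_i ≥ 1 for all i < c.
Admissibleℕ : ∀ {n} → (Fin n → ℕ) → ℕ → Set
Admissibleℕ {n} d c =
  ∀ k → k + c ≤ n → ∑[ j < k ] at d (c + toℕ j) ≤ ∑[ i < c ] ((at d (toℕ i) ∸ 1) ⊓ k)

pos-∸1-⊓ : ∀ {x} k → 1 ≤ x → (ℤ.+ x ℤ.- ℤ.+ 1) ℤ.⊓ ℤ.+ k ≡ ℤ.+ ((x ∸ 1) ⊓ k)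
pos-∸1-⊓ {suc x} k _ = refl

Admissibleℕ⇒Admissible : ∀ {n} (d : Fin n → ℕ) ℓ → 2 * ℓ ≤ n →
  (∀ i → i < 2 * ℓ → 1 ≤ at d i) → Admissibleℕ d (2 * ℓ) → Admissible d ℓ
Admissibleℕ⇒Admissible d ℓ 2ℓ≤n 1≤d bound = 2ℓ≤n , λ k _ k≤n∸2ℓ →
  subst₂ ℤ._≤_ (cong ℤ.+_ (≡.sym (sum-upTo k _))) (≡.sym (sum-min k))
         (ℤ.+≤+ (bound k (m≤o∸n⇒m+n≤o k 2ℓ≤n k≤n∸2ℓ)))
  where
  sum-min : ∀ k → sumℤ (map (λ i → (ℤ.+ at d i ℤ.- ℤ.+ 1) ℤ.⊓ ℤ.+ k) (upTo (2 * ℓ)))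
                ≡ ℤ.+ ∑[ i < 2 * ℓ ] ((at d (toℕ i) ∸ 1) ⊓ k)
  sum-min k = begin
    sumℤ (map (λ i → (ℤ.+ at d i ℤ.- ℤ.+ 1) ℤ.⊓ ℤ.+ k) (upTo (2 * ℓ)))
      ≡⟨ cong sumℤ (map-cong-local (applyUpTo⁺₁ (λ i → i) (2 * ℓ)
                                      (λ {i} i<2ℓ → pos-∸1-⊓ k (1≤d i i<2ℓ)))) ⟩
    sumℤ (map (λ i → ℤ.+ ((at d i ∸ 1) ⊓ k)) (upTo (2 * ℓ)))
      ≡⟨ sumℤ-+ (λ i → (at d i ∸ 1) ⊓ k) (upTo (2 * ℓ)) ⟩
    ℤ.+ sum (map (λ i → (at d i ∸ 1) ⊓ k) (upTo (2 * ℓ)))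
      ≡⟨ cong ℤ.+_ (sum-upTo (2 * ℓ) _) ⟩
    ℤ.+ ∑[ i < 2 * ℓ ] ((at d (toℕ i) ∸ 1) ⊓ k)
      ∎
    where open ≡.≡-Reasoning

module _ {n} (G : SimpleGraph n) where
  open import Data.List.Membership.DecPropositional (_≟_ {n}) using (_∈_; _∉_; _∈?_)

  degree≡∑ : ∀ v → degree G v ≡ ∑[ u < n ] (adj G v u · 1)
  degree≡∑ v = sum-allFin (λ u → adj G v u · 1)

  adj⇒≢ : ∀ {u v} → adj G u v ≡ true → ¬ u ≡ v
  adj⇒≢ {u} uv refl with () ← trans (≡.sym uv) (irrefl G u)

  ∑-neighbours+1≤degree : (s : Fin n → Bool) → ∀ {w p} → adj G w p ≡ true → ¬ T (s p) →
    (∑[ v < n ] (s v · adj G w v · 1)) + 1 ≤ degree G w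
  ∑-neighbours+1≤degree s {w} wp p∉s =
    subst₂ (λ x y → (∑[ v < n ] (s v · adj G w v · 1)) + x · 1 ≤ y) wp (≡.sym (degree≡∑ w))
           (∑-restrict+outside≤∑ s (λ v → adj G w v · 1) p∉s)

  adj⇒1≤degree : ∀ {w p} → adj G w p ≡ true → 1 ≤ degree G w
  adj⇒1≤degree wp = ≤-trans (m≤n+m 1 _) (∑-neighbours+1≤degree (λ _ → false) wp (λ ()))

  ∑-neighbours≤ : (s : Fin n → Bool) → ∀ {w p} → adj G w p ≡ true → ¬ T (s p) →
    ∑[ v < n ] (s v · adj G w v · 1) ≤ (degree G w ∸ 1) ⊓ ∣ s ∣
  ∑-neighbours≤ s {w} wp p∉s =
    ⊓-glb (m+n≤o⇒m≤o∸n _ (∑-neighbours+1≤degree s wp p∉s))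
          (∑-mono-≤ (λ v → ·-monoʳ-≤ (s v) (·-≤ (adj G w v) 1)))

  ∑-degree≤∑-min : (s b : Fin n → Bool) →
    (∀ v w → T (s v) → adj G v w ≡ true → T (b w)) →
    (∀ w → T (b w) → ∃[ p ] adj G w p ≡ true × ¬ T (s p)) →
    ∑[ v < n ] (s v · degree G v) ≤ ∑[ w < n ] (b w · ((degree G w ∸ 1) ⊓ ∣ s ∣))
  ∑-degree≤∑-min s b N[s]⊆b partner = begin
    ∑[ v < n ] (s v · degree G v)
      ≡⟨ sum-cong-≗ (λ v → cong (s v ·_) (degree≡∑ v)) ⟩
    ∑[ v < n ] (s v · ∑[ w < n ] (adj G v w · 1))
      ≡⟨ sum-cong-≗ (λ v → ·-∑ (s v) (λ w → adj G v w · 1)) ⟩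
    ∑[ v < n ] ∑[ w < n ] (s v · adj G v w · 1)
      ≤⟨ ∑-mono-≤ (λ v → ∑-mono-≤ (edge-into-b v)) ⟩
    ∑[ v < n ] ∑[ w < n ] (b w · s v · adj G w v · 1)
      ≡⟨ ∑-comm (λ v w → b w · s v · adj G w v · 1) ⟩
    ∑[ w < n ] ∑[ v < n ] (b w · s v · adj G w v · 1)
      ≡⟨ sum-cong-≗ (λ w → ≡.sym (·-∑ (b w) (λ v → s v · adj G w v · 1))) ⟩
    ∑[ w < n ] (b w · ∑[ v < n ] (s v · adj G w v · 1))
      ≤⟨ ∑-mono-≤ bound ⟩
    ∑[ w < n ] (b w · ((degree G w ∸ 1) ⊓ ∣ s ∣))
      ∎
    where
    open ≤-Reasoning
    edge-into-b : ∀ v w → s v · adj G v w · 1 ≤ b w · s v · adj G w v · 1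
    edge-into-b v w rewrite sym G v w with s v in sv | adj G w v in wv | b w in bw
    ... | false | _     | _     = z≤n
    ... | true  | false | _     = z≤n
    ... | true  | true  | true  = ≤-refl
    ... | true  | true  | false =
      ⊥-elim (subst T bw (N[s]⊆b v w (subst T (≡.sym sv) _) (trans (sym G v w) wv)))
    bound : ∀ w → b w · ∑[ v < n ] (s v · adj G w v · 1) ≤ b w · ((degree G w ∸ 1) ⊓ ∣ s ∣)
    bound w with b w in bw
    ... | false = z≤n
    ... | true with p , wp , p∉s ← partner w (subst T (≡.sym bw) _) = ∑-neighbours≤ s wp p∉s

  ∈⇒T-∈? : ∀ {v xs} → v ∈ xs → T (does (v ∈? xs))
  ∈⇒T-∈? {v} {xs} v∈ with v ∈? xs
  ... | yes _  = _
  ... | no  v∉ = v∉ v∈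

  T-∈?⇒∈ : ∀ {v xs} → T (does (v ∈? xs)) → v ∈ xs
  T-∈?⇒∈ {v} {xs} _ with v ∈? xs
  ... | yes v∈ = v∈

  ∣∈?∣≡length : ∀ xs → Unique xs → ∣ (λ v → does (v ∈? xs)) ∣ ≡ length xs
  ∣∈?∣≡length []       _                  = sum-replicate-zero n
  ∣∈?∣≡length (x ∷ xs) (x∉xs ∷ xs-unique) = begin
    ∣ (λ v → does (v ∈? x ∷ xs)) ∣
      ≡⟨ sum-cong-≗ split ⟩
    ∑[ v < n ] (does (v ≟ x) · 1 + does (v ∈? xs) · 1)
      ≡⟨ ∑-distrib-+ (λ v → does (v ≟ x) · 1) (λ v → does (v ∈? xs) · 1) ⟩
    ∣ (λ v → does (v ≟ x)) ∣ + ∣ (λ v → does (v ∈? xs)) ∣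
      ≡⟨ cong₂ _+_ (∣≟∣≡1 x) (∣∈?∣≡length xs xs-unique) ⟩
    suc (length xs)
      ∎
    where
    open ≡.≡-Reasoning
    split : ∀ v → does (v ∈? x ∷ xs) · 1 ≡ does (v ≟ x) · 1 + does (v ∈? xs) · 1
    split v with v ≟ x
    ... | no  _    = refl
    ... | yes refl = cong (λ b → suc (b · 1)) (≡.sym (dec-false (x ∈? xs) (All¬⇒¬Any x∉xs)))

  endpoints : Fin n × Fin n → List (Fin n)
  endpoints (u , v) = u ∷ v ∷ []

  length-endpoints : ∀ M → length (concatMap endpoints M) ≡ 2 * length M
  length-endpoints []      = refl
  length-endpoints (_ ∷ M) =
    trans (cong (2 +_) (length-endpoints M)) (≡.sym (*-suc 2 (length M)))

  matched-partner : ∀ M → All (λ e → adj G (proj₁ e) (proj₂ e) ≡ true) M →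
    ∀ {w} → w ∈ concatMap endpoints M → ∃[ p ] adj G w p ≡ true × p ∈ concatMap endpoints M
  matched-partner ((u , v) ∷ M) (uv ∷ _) (here refl)         = v , uv , there (here refl)
  matched-partner ((u , v) ∷ M) (uv ∷ _) (there (here refl)) = u , trans (sym G v u) uv , here refl
  matched-partner (_ ∷ M) (_ ∷ edges) (there (there w∈))
    with p , wp , p∈ ← matched-partner M edges w∈ = p , wp , there (there p∈)

  unmatched-nonadjacent : ∀ {M} → IsMaximalMatching G M → ∀ {u v} →
    u ∉ concatMap endpoints M → v ∉ concatMap endpoints M → ¬ adj G u v ≡ true
  unmatched-nonadjacent ((edges , unique) , maximal) {u} {v} u∉ v∉ uv =
    maximal u v uv ((uv ∷ edges) , (adj⇒≢ uv ∷ ¬Any⇒All¬ _ u∉) ∷ ¬Any⇒All¬ _ v∉ ∷ unique)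

  module _ {d : Fin n → ℕ} {M} (d↓ : Arranged d) (realizes : Realizes G d)
           (M-maximal : IsMaximalMatching G M) where

    private
      edges = proj₁ (proj₁ M-maximal)

    matched : Fin n → Bool
    matched v = does (v ∈? concatMap endpoints M)

    ∣matched∣ : ∣ matched ∣ ≡ 2 * length M
    ∣matched∣ = trans (∣∈?∣≡length _ (proj₂ (proj₁ M-maximal))) (length-endpoints M)

    maximal-matching-Admissibleℕ : Admissibleℕ d ∣ matched ∣
    maximal-matching-Admissibleℕ k k+∣matched∣≤n
      with s , s∩matched=∅ , ∣s∣≡k , dominates ←
           ∃-disjoint-dominating-window d d↓ matched k k+∣matched∣≤n = begin
      ∑[ j < k ] at d (∣ matched ∣ + toℕ j)
        ≤⟨ dominates ⟩
      ∑[ v < n ] (s v · d v)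
        ≡⟨ sum-cong-≗ (λ v → cong (s v ·_) (≡.sym (realizes v))) ⟩
      ∑[ v < n ] (s v · degree G v)
        ≤⟨ ∑-degree≤∑-min s matched N[s]⊆matched partner ⟩
      ∑[ w < n ] (matched w · ((degree G w ∸ 1) ⊓ ∣ s ∣))
        ≡⟨ sum-cong-≗ (λ w → cong₂ (λ x y → matched w · ((x ∸ 1) ⊓ y)) (realizes w) ∣s∣≡k) ⟩
      ∑[ w < n ] (matched w · g (d w))
        ≤⟨ ∑-restrict≤∑-prefix (g ∘ d) (Arranged-∘ d g-mono d↓) matched ⟩
      ∑[ i < ∣ matched ∣ ] at (g ∘ d) (toℕ i)
        ≤⟨ ∑-mono-≤ {n = ∣ matched ∣} (λ i → at-∘ d g (toℕ i)) ⟩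
      ∑[ i < ∣ matched ∣ ] g (at d (toℕ i))
        ∎
      where
      open ≤-Reasoning
      g : ℕ → ℕ
      g x = (x ∸ 1) ⊓ k
      g-mono : ∀ {x y} → x ≤ y → g x ≤ g y
      g-mono x≤y = ⊓-monoˡ-≤ k (∸-monoˡ-≤ 1 x≤y)
      unmatched : ∀ {v} → T (s v) → v ∉ concatMap endpoints M
      unmatched {v} sv v∈ = s∩matched=∅ v sv (∈⇒T-∈? v∈)
      N[s]⊆matched : ∀ v w → T (s v) → adj G v w ≡ true → T (matched w)
      N[s]⊆matched v w sv vw with w ∈? concatMap endpoints M
      ... | yes _  = _
      ... | no  w∉ = unmatched-nonadjacent M-maximal (unmatched sv) w∉ vw
      partner : ∀ w → T (matched w) → ∃[ p ] adj G w p ≡ true × ¬ T (s p)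
      partner w w∈ with p , wp , p∈ ← matched-partner M edges (T-∈?⇒∈ w∈) =
        p , wp , λ sp → unmatched sp p∈

    maximal-matching-Admissible : Admissible d (length M)
    maximal-matching-Admissible =
      Admissibleℕ⇒Admissible d (length M) (subst (_≤ n) ∣matched∣ (∣∣≤n matched))
        (λ i i<2m → ≤-at-prefix d d↓ matched matched⇒1≤d i
                      (subst (i <_) (≡.sym ∣matched∣) i<2m))
        (subst (Admissibleℕ d) ∣matched∣ maximal-matching-Admissibleℕ)
      where
      matched⇒1≤d : ∀ v → T (matched v) → 1 ≤ d v
      matched⇒1≤d v v∈ with _ , vp , _ ← matched-partner M edges (T-∈?⇒∈ v∈) =
        subst (1 ≤_) (realizes v) (adj⇒1≤degree vp)

theorem5p2 : ∀ (n : ℕ) (d : Fin n → ℕ) → Arranged d →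
    ∀ (ℓ* : ℕ) → IsLStar d ℓ* →
    ∀ (G : SimpleGraph n) → Realizes G d →
    ∀ (M : List (Fin n × Fin n)) → IsMaximalMatching G M →
    ℓ* ≤ length M
theorem5p2 n d d↓ ℓ* (_ , ℓ*-minimal) G realizes M M-maximal =
  ℓ*-minimal (length M) (maximal-matching-Admissible G d↓ realizes M-maximal)
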